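{- Let $n \geq 3$ be an integer and let $J_n(1)$ be the finite Jaco graph on $n$ vertices. Let $v_i$ be the prime Jaconian vertex of $J_n(1)$. Then $\Upsilon(J_n(1)) = i$ if the edge $v_iv_n$ is not an edge of $J_n(1)$, and $\Upsilon(J_n(1)) = i-1$ otherwise.
   Context: The infinite Jaco graph $J_\infty(1)$ is the directed graph with vertex set $\{v_i : i \in \mathbb{N}\}$ (with $\mathbb{N}=\{1,2,\dots\}$), whose arcs are defined recursively: for $i<j$, $(v_i,v_j)$ is an arc if and only if $2i - d^-(v_i) \geq j$, where $d^-(v_i)$ is the in-degree of $v_i$ in $J_\infty(1)$ (this is well defined since it depends only on arcs from vertices $v_k$, $k<i$); there are no arcs $(v_j,v_i)$ with $j>i$. The finite Jaco graph $J_n(1)$ is the subgraph induced on $v_1,\dots,v_n$. Degrees in $J_n(1)$ are degrees in its underlying undirected graph (in-degree plus out-degree within $J_n(1)$); the Jaconian vertices are the vertices of $J_n(1)$ attaining the maximum degree $\Delta(J_n(1))$, and the prime Jaconian vertex is the Jaconian vertex of lowest index. "The edge $v_iv_n$" means adjacency of $v_i$ and $v_n$ in the underlying graph. The McPherson number of $J_n(1)$ is that of its underlying simple graph: vertex explosions start from $G'_0 = G$; given the current mixed graph $G'_i$ with underlying simple graph $G^*_i$, exploding a vertex $w$ adds an arc $(w,z)$ for every vertex $z\neq w$ not adjacent to $w$ in $G^*_i$; $\Upsilon(G)$ is the minimum number $\ell$ of successive explosions after which $G^*_\ell \cong K_n$. -}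

module Defs where

open import Data.Bool using (Bool; true; false; _∨_; _∧_; not; T)
open import Data.Nat using (ℕ; zero; suc; _+_; _*_; _∸_; _≤_; _<_; _≤ᵇ_; _<ᵇ_)
open import Data.Fin using (Fin; toℕ; fromℕ)
open import Data.Fin.Properties using () renaming (_≟_ to _≟F_)
open import Data.List using (List; []; _∷_; _++_; length; filterᵇ; allFin; foldl)
open import Data.Product using (Σ; _×_; _,_)
open import Relation.Nullary using (¬_)
open import Relation.Nullary.Decidable using (⌊_⌋)
open import Relation.Binary.PropositionalEquality using (_≡_; _≢_)

-- The infinite Jaco graph J_∞(1).  Vertices are v_1, v_2, ... (1-based).
-- reaches m = [ r(1) , ... , r(m) ]  where  r(k) = 2k - d⁻(v_k), so that
-- for k < j, (v_k , v_j) is an arc iff j ≤ r(k).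
-- d⁻(v_i) = #{ k < i : r(k) ≥ i }.

countGeq : ℕ → List ℕ → ℕ
countGeq i rs = length (filterᵇ (λ r → i ≤ᵇ r) rs)

reaches : ℕ → List ℕ
reaches zero    = []
reaches (suc m) = reaches m ++ (2 * suc m ∸ countGeq (suc m) (reaches m) ∷ [])

indeg : ℕ → ℕ
indeg i = countGeq i (reaches (i ∸ 1))

reach : ℕ → ℕ
reach i = 2 * i ∸ indeg i

arcᵇ : ℕ → ℕ → Bool
arcᵇ i j = (i <ᵇ j) ∧ (j ≤ᵇ reach i)

Graph : ℕ → Set
Graph n = Fin n → Fin n → Bool

-- vertex index of  x : Fin n  is  toℕ x + 1  (x = v_{toℕ x + 1})
label : ∀ {n} → Fin n → ℕ
label x = suc (toℕ x)

-- underlying simple graph of the finite Jaco graph J_n(1)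
Jaco : (n : ℕ) → Graph n
Jaco n x y = arcᵇ (label x) (label y) ∨ arcᵇ (label y) (label x)

Adj : ∀ {n} → Graph n → Fin n → Fin n → Set
Adj G x y = T (G x y)

degree : ∀ {n} → Graph n → Fin n → ℕ
degree {n} G x = length (filterᵇ (G x) (allFin n))

IsMaxDegree : ∀ {n} → Graph n → Fin n → Set
IsMaxDegree {n} G x = (y : Fin n) → degree G y ≤ degree G x

IsPrimeJaconian : ∀ {n} → Graph n → Fin n → Set
IsPrimeJaconian {n} G x =
  IsMaxDegree G x × ((y : Fin n) → IsMaxDegree G y → toℕ x ≤ toℕ y)

-- Vertex explosions and the McPherson number.
-- Exploding w adds an arc (w,z) for each z ≠ w not adjacent to w; in the
-- underlying simple graph this makes w adjacent to every other vertex.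

explode : ∀ {n} → Graph n → Fin n → Graph n
explode G w x y =
  G x y ∨ ((⌊ x ≟F w ⌋ ∨ ⌊ y ≟F w ⌋) ∧ not ⌊ x ≟F y ⌋)

explodeAll : ∀ {n} → Graph n → List (Fin n) → Graph n
explodeAll G ws = foldl explode G ws

IsComplete : ∀ {n} → Graph n → Set
IsComplete {n} G = (x y : Fin n) → x ≢ y → Adj G x y

McPhersonNumber : ∀ {n} → Graph n → ℕ → Set
McPhersonNumber {n} G m =
  Σ (List (Fin n)) (λ ws → length ws ≡ m × IsComplete (explodeAll G ws))
  × ((ws : List (Fin n)) → IsComplete (explodeAll G ws) → m ≤ length ws)

-- Index vertices from 0, so that a stands for v_{a+1}.  The in-degree d⁻
-- grows by at most one from a vertex to the next, so the out-degree
-- d⁺(a) = a + 1 − d⁻(a) is nondecreasing, and the out-neighbours of a are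
-- exactly a+1, …, r(a) − 1 where r(a) = a + 1 + d⁺(a) is increasing.  In
-- J_{k+1}(1) vertex a therefore has degree d⁻(a) + min(k − a, d⁺(a)): it is
-- a + 1 as long as r(a) ≤ k, and it no longer increases once r(a) > k.  Let
-- b be the last vertex with r(b) ≤ k.  The prime Jaconian vertex is b + 1 if
-- it is adjacent to the last vertex v_n, and b otherwise; in both cases the
-- claim is Υ(J_{k+1}(1)) = b + 1.  Exploding 0, …, b suffices, since every
-- later vertex already reaches all its successors.  Conversely, if c ≤ b is
-- the first vertex left unexploded, then the c vertices before it and the
-- k + 1 − r(c) vertices it does not reach must all be exploded, and
-- r(c) − c ≤ r(b) − b makes these at least b + 1.
module Submission where

open import Defs
open import Data.Bool using (Bool; true; false; _∨_; T)
open import Data.Bool.Properties using (∨-identityʳ; ∨-zeroʳ; ∨-comm; T-∨)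
open import Data.Empty using (⊥-elim)
open import Data.Fin as Fin using (Fin; toℕ; fromℕ; fromℕ<)
open import Data.Fin.Properties using (toℕ-fromℕ; toℕ-fromℕ<; toℕ-injective; toℕ<n)
  renaming (_≟_ to _≟F_)
open import Data.List using (List; []; _∷_; _++_; [_]; length; filterᵇ; allFin; tabulate)
open import Data.Bool.ListAction using (any)
open import Data.List.Membership.Propositional using (_∈_; _∉_)
open import Data.List.Membership.Propositional.Properties using (∈-filter⁺; ∈-allFin)
open import Data.List.Relation.Unary.Any using (here; there; any?)
open import Data.Nat
open import Data.Nat.Properties
open import Algebra.Properties.CommutativeSemigroup +-commutativeSemigroup
  using () renaming (interchange to +-interchange)
open import Data.Product using (_×_; _,_; proj₁; proj₂; ∃-syntax)
open import Data.Sum using (_⊎_; inj₁; inj₂; [_,_]′)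
open import Function using (_∘_; Equivalence)
open import Relation.Binary.Definitions using (tri<; tri≈; tri>)
open import Relation.Binary.PropositionalEquality using (_≡_; _≢_; refl; sym; trans; cong; cong₂; subst; subst₂; module ≡-Reasoning)
open import Relation.Nullary using (¬_; yes; no)
open import Relation.Nullary.Decidable using (T?)

T⇒≡true : ∀ {b} → T b → b ≡ true
T⇒≡true {true} _ = refl

¬T⇒≡false : ∀ {b} → ¬ T b → b ≡ false
¬T⇒≡false {true}  ¬t = ⊥-elim (¬t _)
¬T⇒≡false {false} _  = refl

T-∨ˡ : ∀ {a} b → T a → T (a ∨ b)
T-∨ˡ b t = Equivalence.from T-∨ (inj₁ t)

T-∨ʳ : ∀ a {b} → T b → T (a ∨ b)
T-∨ʳ a t = Equivalence.from T-∨ (inj₂ t)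

<ᵇ-cancelˡ : ∀ a m n → (a + m <ᵇ a + n) ≡ (m <ᵇ n)
<ᵇ-cancelˡ zero    m n = refl
<ᵇ-cancelˡ (suc a) m n = <ᵇ-cancelˡ a m n

boolToℕ : Bool → ℕ
boolToℕ true  = 1
boolToℕ false = 0

boolToℕ≤1 : ∀ b → boolToℕ b ≤ 1
boolToℕ≤1 true  = ≤-refl
boolToℕ≤1 false = z≤n

boolToℕ-mono : ∀ {a b} → (T a → T b) → boolToℕ a ≤ boolToℕ b
boolToℕ-mono {false}        _ = z≤n
boolToℕ-mono {true} {true}  _ = ≤-refl
boolToℕ-mono {true} {false} f = ⊥-elim (f _)

boolToℕ-∨ : ∀ a b → boolToℕ (a ∨ b) ≤ boolToℕ a + boolToℕ b
boolToℕ-∨ true  b = s≤s z≤n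
boolToℕ-∨ false b = ≤-refl

count : ℕ → (ℕ → Bool) → ℕ
count zero    f = 0
count (suc m) f = count m f + boolToℕ (f m)

count-cong : ∀ m {f g} → (∀ t → t < m → f t ≡ g t) → count m f ≡ count m g
count-cong zero    eq = refl
count-cong (suc m) eq =
  cong₂ _+_ (count-cong m (λ t t<m → eq t (m≤n⇒m≤1+n t<m))) (cong boolToℕ (eq m ≤-refl))

count-mono : ∀ m {f g} → (∀ t → t < m → T (f t) → T (g t)) → count m f ≤ count m g
count-mono zero    f⇒g = z≤n
count-mono (suc m) f⇒g =
  +-mono-≤ (count-mono m (λ t t<m → f⇒g t (m≤n⇒m≤1+n t<m))) (boolToℕ-mono (f⇒g m ≤-refl))

count≤ : ∀ m f → count m f ≤ m
count≤ zero    f = z≤n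
count≤ (suc m) f = ≤-trans (+-mono-≤ (count≤ m f) (boolToℕ≤1 (f m))) (≤-reflexive (+-comm m 1))

count-false : ∀ m → count m (λ _ → false) ≡ 0
count-false zero    = refl
count-false (suc m) = trans (+-identityʳ _) (count-false m)

count-true : ∀ m → count m (λ _ → true) ≡ m
count-true zero    = refl
count-true (suc m) = trans (cong (_+ 1) (count-true m)) (+-comm m 1)

count-+ : ∀ m n f → count (m + n) f ≡ count m f + count n (λ s → f (m + s))
count-+ m zero    f = trans (cong (λ z → count z f) (+-identityʳ m)) (sym (+-identityʳ _))
count-+ m (suc n) f = begin
  count (m + suc n) f
    ≡⟨ cong (λ z → count z f) (+-suc m n) ⟩
  count (m + n) f + boolToℕ (f (m + n))
    ≡⟨ cong (_+ boolToℕ (f (m + n))) (count-+ m n f) ⟩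
  count m f + count n (λ s → f (m + s)) + boolToℕ (f (m + n))
    ≡⟨ +-assoc (count m f) _ _ ⟩
  count m f + count (suc n) (λ s → f (m + s))
    ∎
  where open ≡-Reasoning

count-∨ : ∀ m f g → count m (λ s → f s ∨ g s) ≤ count m f + count m g
count-∨ zero    f g = z≤n
count-∨ (suc m) f g = begin
  count m (λ s → f s ∨ g s) + boolToℕ (f m ∨ g m)
    ≤⟨ +-mono-≤ (count-∨ m f g) (boolToℕ-∨ (f m) (g m)) ⟩
  (count m f + count m g) + (boolToℕ (f m) + boolToℕ (g m))
    ≡⟨ +-interchange (count m f) (count m g) (boolToℕ (f m)) (boolToℕ (g m)) ⟩
  (count m f + boolToℕ (f m)) + (count m g + boolToℕ (g m))
    ∎
  where open ≤-Reasoning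

count-<ᵇ : ∀ m e → count m (_<ᵇ e) ≡ m ⊓ e
count-<ᵇ zero    e = refl
count-<ᵇ (suc m) e with m <? e
... | yes m<e = begin
  count m (_<ᵇ e) + boolToℕ (m <ᵇ e) ≡⟨ cong₂ _+_ (count-<ᵇ m e) (cong boolToℕ (T⇒≡true (<⇒<ᵇ m<e))) ⟩
  m ⊓ e + 1                         ≡⟨ cong (_+ 1) (m≤n⇒m⊓n≡m (<⇒≤ m<e)) ⟩
  m + 1                             ≡⟨ +-comm m 1 ⟩
  suc m                             ≡⟨ m≤n⇒m⊓n≡m m<e ⟨
  suc m ⊓ e                         ∎
  where open ≡-Reasoning
... | no m≮e = begin
  count m (_<ᵇ e) + boolToℕ (m <ᵇ e) ≡⟨ cong₂ _+_ (count-<ᵇ m e) (cong boolToℕ (¬T⇒≡false (m≮e ∘ <ᵇ⇒< m e))) ⟩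
  m ⊓ e + 0                         ≡⟨ +-identityʳ _ ⟩
  m ⊓ e                             ≡⟨ m≥n⇒m⊓n≡n (≮⇒≥ m≮e) ⟩
  e                                 ≡⟨ m≥n⇒m⊓n≡n (m≤n⇒m≤1+n (≮⇒≥ m≮e)) ⟨
  suc m ⊓ e                         ∎
  where open ≡-Reasoning

count-≡ᵇ-below : ∀ m x → m ≤ x → count m (_≡ᵇ x) ≡ 0
count-≡ᵇ-below zero    x _   = refl
count-≡ᵇ-below (suc m) x m<x =
  cong₂ _+_ (count-≡ᵇ-below m x (<⇒≤ m<x)) (cong boolToℕ (¬T⇒≡false (<⇒≢ m<x ∘ ≡ᵇ⇒≡ m x)))

count-≡ᵇ≤1 : ∀ m x → count m (_≡ᵇ x) ≤ 1
count-≡ᵇ≤1 zero    x = z≤n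
count-≡ᵇ≤1 (suc m) x with m ≟ x
... | yes refl = +-mono-≤ (≤-reflexive (count-≡ᵇ-below m m ≤-refl)) (boolToℕ≤1 (m ≡ᵇ m))
... | no m≢x   = +-mono-≤ (count-≡ᵇ≤1 m x) (≤-reflexive (cong boolToℕ (¬T⇒≡false (m≢x ∘ ≡ᵇ⇒≡ m x))))

count-any-≡ᵇ≤length : ∀ {A : Set} m (f : A → ℕ) xs →
  count m (λ s → any (λ x → s ≡ᵇ f x) xs) ≤ length xs
count-any-≡ᵇ≤length m f []       = ≤-reflexive (count-false m)
count-any-≡ᵇ≤length m f (x ∷ xs) =
  ≤-trans (count-∨ m (_≡ᵇ f x) (λ s → any (λ y → s ≡ᵇ f y) xs))
          (+-mono-≤ (count-≡ᵇ≤1 m (f x)) (count-any-≡ᵇ≤length m f xs))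

count-outside : ∀ {c r N} → c ≤ r → r ≤ N →
  count N (λ s → (s <ᵇ c) ∨ (r ≤ᵇ s)) ≡ c + (N ∸ r)
count-outside {c} {r} {N} c≤r r≤N = begin
  count N g
    ≡⟨ cong (λ z → count z g) (sym (m+[n∸m]≡n r≤N)) ⟩
  count (r + (N ∸ r)) g
    ≡⟨ count-+ r (N ∸ r) g ⟩
  count r g + count (N ∸ r) (λ s → g (r + s))
    ≡⟨ cong₂ _+_ (count-cong r below) (count-cong (N ∸ r) above) ⟩
  count r (_<ᵇ c) + count (N ∸ r) (λ _ → true)
    ≡⟨ cong₂ _+_ (trans (count-<ᵇ r c) (m≥n⇒m⊓n≡n c≤r)) (count-true (N ∸ r)) ⟩
  c + (N ∸ r)
    ∎
  where
  open ≡-Reasoning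
  g : ℕ → Bool
  g s = (s <ᵇ c) ∨ (r ≤ᵇ s)
  below : ∀ s → s < r → g s ≡ (s <ᵇ c)
  below s s<r = trans (cong ((s <ᵇ c) ∨_) (¬T⇒≡false (<⇒≱ s<r ∘ ≤ᵇ⇒≤ r s))) (∨-identityʳ _)
  above : ∀ s → s < N ∸ r → g (r + s) ≡ true
  above s _ = trans (cong ((r + s <ᵇ c) ∨_) (T⇒≡true (≤⇒≤ᵇ (m≤m+n r s)))) (∨-zeroʳ _)

length-filterᵇ-tabulate : ∀ {A : Set} n (g : Fin n → A) (p : A → Bool) (f : ℕ → Bool) →
  (∀ i → p (g i) ≡ f (toℕ i)) → length (filterᵇ p (tabulate g)) ≡ count n f
length-filterᵇ-tabulate zero    g p f eq = refl
length-filterᵇ-tabulate (suc n) g p f eq = begin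
  length (filterᵇ p (tabulate g))             ≡⟨ head-tail ⟩
  boolToℕ (f 0) + count n (λ t → f (suc t))  ≡⟨ count-+ 1 n f ⟨
  count (suc n) f                             ∎
  where
  open ≡-Reasoning
  tail : length (filterᵇ p (tabulate (g ∘ Fin.suc))) ≡ count n (λ t → f (suc t))
  tail = length-filterᵇ-tabulate n (g ∘ Fin.suc) p (λ t → f (suc t)) (eq ∘ Fin.suc)
  head-tail : length (filterᵇ p (tabulate g)) ≡ boolToℕ (f 0) + count n (λ t → f (suc t))
  head-tail with p (g Fin.zero) | eq Fin.zero
  ... | true  | e rewrite sym e = cong suc tail
  ... | false | e rewrite sym e = tail

all<-or-least-counterexample : ∀ (f : ℕ → Bool) N →
  (∀ s → s < N → T (f s)) ⊎ ∃[ c ] c < N × ¬ T (f c) × (∀ s → s < c → T (f s))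
all<-or-least-counterexample f zero = inj₁ (λ _ ())
all<-or-least-counterexample f (suc N) with all<-or-least-counterexample f N
... | inj₂ (c , c<N , ¬fc , below) = inj₂ (c , m≤n⇒m≤1+n c<N , ¬fc , below)
... | inj₁ below with f N in eq
...   | true  = inj₁ (λ s s<1+N → extend s (m<1+n⇒m<n∨m≡n s<1+N))
  where
  extend : ∀ s → s < N ⊎ s ≡ N → T (f s)
  extend s (inj₁ s<N)  = below s s<N
  extend s (inj₂ refl) = subst T (sym eq) _
...   | false = inj₂ (N , ≤-refl , subst T eq , below)

d⁻ : ℕ → ℕ
d⁻ a = indeg (suc a)

d⁺ : ℕ → ℕ
d⁺ a = suc a ∸ d⁻ a

r : ℕ → ℕ
r a = reach (suc a)

countGeq-reaches : ∀ i m → countGeq i (reaches m) ≡ count m (λ t → i ≤ᵇ r t)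
countGeq-reaches i zero    = refl
countGeq-reaches i (suc m) = begin
  countGeq i (reaches m ++ [ r m ])                  ≡⟨ length-filterᵇ-snoc (reaches m) ⟩
  countGeq i (reaches m) + boolToℕ (i ≤ᵇ r m)        ≡⟨ cong (_+ boolToℕ (i ≤ᵇ r m)) (countGeq-reaches i m) ⟩
  count m (λ t → i ≤ᵇ r t) + boolToℕ (i ≤ᵇ r m)      ∎
  where
  open ≡-Reasoning
  length-filterᵇ-snoc : ∀ xs → countGeq i (xs ++ [ r m ]) ≡ countGeq i xs + boolToℕ (i ≤ᵇ r m)
  length-filterᵇ-snoc [] with i ≤ᵇ r m
  ... | true  = refl
  ... | false = refl
  length-filterᵇ-snoc (x ∷ xs) with i ≤ᵇ x
  ... | true  = cong suc (length-filterᵇ-snoc xs)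
  ... | false = length-filterᵇ-snoc xs

d⁻-count : ∀ a → d⁻ a ≡ count a (λ t → suc a ≤ᵇ r t)
d⁻-count a = countGeq-reaches (suc a) a

d⁻≤ : ∀ a → d⁻ a ≤ a
d⁻≤ a = ≤-trans (≤-reflexive (d⁻-count a)) (count≤ a _)

-- A vertex before a that reaches a + 1 also reaches a; only a itself can be new.
d⁻-suc≤ : ∀ a → d⁻ (suc a) ≤ suc (d⁻ a)
d⁻-suc≤ a = begin
  d⁻ (suc a)
    ≡⟨ d⁻-count (suc a) ⟩
  count a (λ t → 2 + a ≤ᵇ r t) + boolToℕ (2 + a ≤ᵇ r a)
    ≤⟨ +-mono-≤ (count-mono a (λ t _ → ≤⇒≤ᵇ ∘ ≤-trans (n≤1+n (suc a)) ∘ ≤ᵇ⇒≤ (2 + a) (r t)))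
                (boolToℕ≤1 _) ⟩
  count a (λ t → suc a ≤ᵇ r t) + 1
    ≡⟨ cong (_+ 1) (d⁻-count a) ⟨
  d⁻ a + 1
    ≡⟨ +-comm (d⁻ a) 1 ⟩
  suc (d⁻ a)
    ∎
  where open ≤-Reasoning

d⁻+d⁺ : ∀ a → d⁻ a + d⁺ a ≡ suc a
d⁻+d⁺ a = m+[n∸m]≡n (m≤n⇒m≤1+n (d⁻≤ a))

r≡ : ∀ a → r a ≡ suc a + d⁺ a
r≡ a = begin
  2 * suc a ∸ d⁻ a         ≡⟨ cong (λ z → suc a + z ∸ d⁻ a) (+-identityʳ (suc a)) ⟩
  (suc a + suc a) ∸ d⁻ a   ≡⟨ +-∸-assoc (suc a) (m≤n⇒m≤1+n (d⁻≤ a)) ⟩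
  suc a + d⁺ a             ∎
  where open ≡-Reasoning

2+a≤r : ∀ a → 2 + a ≤ r a
2+a≤r a = begin
  2 + a        ≡⟨ +-comm 1 (suc a) ⟩
  suc a + 1    ≤⟨ +-monoʳ-≤ (suc a) (m<n⇒0<n∸m (s≤s (d⁻≤ a))) ⟩
  suc a + d⁺ a ≡⟨ r≡ a ⟨
  r a          ∎
  where open ≤-Reasoning

a<r : ∀ a → a < r a
a<r a = ≤-trans (n≤1+n (suc a)) (2+a≤r a)

d⁺-suc : ∀ a → d⁺ a ≤ d⁺ (suc a)
d⁺-suc a = ∸-monoʳ-≤ (2 + a) (d⁻-suc≤ a)

d⁺-mono : ∀ {c b} → c ≤ b → d⁺ c ≤ d⁺ b
d⁺-mono {b = zero} z≤n = ≤-refl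
d⁺-mono {c} {suc b} c≤1+b with m≤n⇒m<n∨m≡n c≤1+b
... | inj₁ c<1+b = ≤-trans (d⁺-mono (≤-pred c<1+b)) (d⁺-suc b)
... | inj₂ refl  = ≤-refl

r-mono : ∀ {c b} → c ≤ b → r c ≤ r b
r-mono {c} {b} c≤b = begin
  r c          ≡⟨ r≡ c ⟩
  suc c + d⁺ c ≤⟨ +-mono-≤ (s≤s c≤b) (d⁺-mono c≤b) ⟩
  suc b + d⁺ b ≡⟨ r≡ b ⟨
  r b          ∎
  where open ≤-Reasoning

r[c]+b≤c+r[b] : ∀ {c b} → c ≤ b → r c + b ≤ c + r b
r[c]+b≤c+r[b] {c} {b} c≤b = begin
  r c + b            ≡⟨ cong (_+ b) (r≡ c) ⟩
  suc c + d⁺ c + b   ≤⟨ +-monoˡ-≤ b (+-monoʳ-≤ (suc c) (d⁺-mono c≤b)) ⟩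
  suc c + d⁺ b + b   ≡⟨ rearrange ⟩
  c + (suc b + d⁺ b) ≡⟨ cong (c +_) (r≡ b) ⟨
  c + r b            ∎
  where
  open ≤-Reasoning
  rearrange : suc c + d⁺ b + b ≡ c + (suc b + d⁺ b)
  rearrange = begin-equality
    suc (c + d⁺ b + b)   ≡⟨ cong suc (+-assoc c (d⁺ b) b) ⟩
    suc (c + (d⁺ b + b)) ≡⟨ +-suc c (d⁺ b + b) ⟨
    c + suc (d⁺ b + b)   ≡⟨ cong (λ z → c + suc z) (+-comm (d⁺ b) b) ⟩
    c + (suc b + d⁺ b)   ∎

-- Jaco (suc k) x y reduces to adjacentᵇ (toℕ x) (toℕ y).
adjacentᵇ : ℕ → ℕ → Bool
adjacentᵇ a b = arcᵇ (suc a) (suc b) ∨ arcᵇ (suc b) (suc a)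

adjacentᵇ-sym : ∀ a b → adjacentᵇ a b ≡ adjacentᵇ b a
adjacentᵇ-sym a b = ∨-comm (arcᵇ (suc a) (suc b)) _

adjacentᵇ-< : ∀ {a b} → a < b → adjacentᵇ a b ≡ (suc b ≤ᵇ r a)
adjacentᵇ-< {a} {b} a<b
  rewrite T⇒≡true (<⇒<ᵇ a<b) | ¬T⇒≡false (<⇒≯ a<b ∘ <ᵇ⇒< b a) = ∨-identityʳ _

adjacentᵇ-> : ∀ {a b} → b < a → adjacentᵇ a b ≡ (suc a ≤ᵇ r b)
adjacentᵇ-> {a} {b} b<a = trans (adjacentᵇ-sym a b) (adjacentᵇ-< b<a)

adjacentᵇ-irrefl : ∀ a → adjacentᵇ a a ≡ false
adjacentᵇ-irrefl a rewrite ¬T⇒≡false (<-irrefl refl ∘ <ᵇ⇒< a a) = refl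

<r⇒adjacent : ∀ {a b} → a < b → b < r a → T (adjacentᵇ a b)
<r⇒adjacent a<b b<ra = subst T (sym (adjacentᵇ-< a<b)) (≤⇒≤ᵇ b<ra)

deg : ℕ → ℕ → ℕ
deg k a = count (suc k) (adjacentᵇ a)

degree-Jaco : ∀ k (y : Fin (suc k)) → degree (Jaco (suc k)) y ≡ deg k (toℕ y)
degree-Jaco k y = length-filterᵇ-tabulate (suc k) (λ z → z) (Jaco (suc k) y) (adjacentᵇ (toℕ y)) (λ _ → refl)

deg-formula : ∀ {k a} → a ≤ k → deg k a ≡ d⁻ a + (k ∸ a) ⊓ d⁺ a
deg-formula {k} {a} a≤k = begin
  count (suc k) f                                         ≡⟨ cong (λ z → count z f) split ⟩
  count (a + suc p) f                                     ≡⟨ count-+ a (suc p) f ⟩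
  count a f + count (suc p) (λ s → f (a + s))             ≡⟨ cong (count a f +_) (count-+ 1 p (λ s → f (a + s))) ⟩
  count a f + (boolToℕ (f (a + 0)) + count p (λ s → f (a + suc s)))
    ≡⟨ cong₂ (λ u v → u + (boolToℕ v + count p (λ s → f (a + suc s))))
             (trans (count-cong a (λ t t<a → adjacentᵇ-> t<a)) (sym (d⁻-count a)))
             (trans (cong f (+-identityʳ a)) (adjacentᵇ-irrefl a)) ⟩
  d⁻ a + count p (λ s → f (a + suc s))                    ≡⟨ cong (d⁻ a +_) (count-cong p (λ s _ → out-neighbour s)) ⟩
  d⁻ a + count p (_<ᵇ d⁺ a)                               ≡⟨ cong (d⁻ a +_) (count-<ᵇ p (d⁺ a)) ⟩
  d⁻ a + p ⊓ d⁺ a                                         ∎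
  where
  open ≡-Reasoning
  f = adjacentᵇ a
  p = k ∸ a
  split : suc k ≡ a + suc p
  split = trans (cong suc (sym (m+[n∸m]≡n a≤k))) (sym (+-suc a p))
  out-neighbour : ∀ s → f (a + suc s) ≡ (s <ᵇ d⁺ a)
  out-neighbour s = begin
    f (a + suc s)                    ≡⟨ adjacentᵇ-< (m<m+n a z<s) ⟩
    (a + suc s <ᵇ r a)               ≡⟨ cong₂ _<ᵇ_ (+-suc a s) (r≡ a) ⟩
    (suc a + s <ᵇ suc a + d⁺ a)      ≡⟨ <ᵇ-cancelˡ (suc a) s (d⁺ a) ⟩
    (s <ᵇ d⁺ a)                      ∎

deg-suc≤ : ∀ {k b} → b < k → k < r b → deg k (suc b) ≤ deg k b
deg-suc≤ {k} {b} b<k k<rb = begin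
  deg k (suc b)                          ≡⟨ deg-formula b<k ⟩
  d⁻ (suc b) + (k ∸ suc b) ⊓ d⁺ (suc b)  ≤⟨ +-mono-≤ (d⁻-suc≤ b) (m⊓n≤m (k ∸ suc b) (d⁺ (suc b))) ⟩
  suc (d⁻ b) + (k ∸ suc b)               ≡⟨ +-suc (d⁻ b) _ ⟨
  d⁻ b + suc (k ∸ suc b)                 ≡⟨ cong (d⁻ b +_) (+-∸-assoc 1 b<k) ⟨
  d⁻ b + (k ∸ b)                         ≡⟨ cong (d⁻ b +_) (m≤n⇒m⊓n≡m k∸b≤d⁺) ⟨
  d⁻ b + (k ∸ b) ⊓ d⁺ b                  ≡⟨ deg-formula (<⇒≤ b<k) ⟨
  deg k b                                ∎
  where
  open ≤-Reasoning
  k∸b≤d⁺ : k ∸ b ≤ d⁺ b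
  k∸b≤d⁺ = m≤n+o⇒m∸n≤o k b (≤-pred (≤-trans k<rb (≤-reflexive (r≡ b))))

deg≡suc : ∀ {k a} → r a ≤ k → deg k a ≡ suc a
deg≡suc {k} {a} ra≤k = begin
  deg k a                   ≡⟨ deg-formula a≤k ⟩
  d⁻ a + (k ∸ a) ⊓ d⁺ a     ≡⟨ cong (d⁻ a +_) (m≥n⇒m⊓n≡n d⁺≤k∸a) ⟩
  d⁻ a + d⁺ a               ≡⟨ d⁻+d⁺ a ⟩
  suc a                     ∎
  where
  open ≡-Reasoning
  a+d⁺≤k : a + d⁺ a ≤ k
  a+d⁺≤k = ≤-trans (n≤1+n _) (≤-trans (≤-reflexive (sym (r≡ a))) ra≤k)
  a≤k : a ≤ k
  a≤k = m+n≤o⇒m≤o a a+d⁺≤k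
  d⁺≤k∸a : d⁺ a ≤ k ∸ a
  d⁺≤k∸a = m+n≤o⇒m≤o∸n (d⁺ a) (≤-trans (≤-reflexive (+-comm (d⁺ a) a)) a+d⁺≤k)

explodeAll-⊇ : ∀ {n} (G : Graph n) ws {x y} → Adj G x y → Adj (explodeAll G ws) x y
explodeAll-⊇ G []       adj = adj
explodeAll-⊇ G (w ∷ ws) adj = explodeAll-⊇ (explode G w) ws (T-∨ˡ _ adj)

explode-adjacent : ∀ {n} (G : Graph n) w {x y} → x ≡ w ⊎ y ≡ w → x ≢ y → Adj (explode G w) x y
explode-adjacent G w {x} {y} x∨y≡w x≢y with x ≟F w | y ≟F w | x ≟F y
... | _     | _     | yes x≡y = ⊥-elim (x≢y x≡y)
... | yes _ | _     | no _    = T-∨ʳ (G x y) _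
... | no _  | yes _ | no _    = T-∨ʳ (G x y) _
... | no x≢w | no y≢w | no _ with x∨y≡w
...   | inj₁ x≡w = ⊥-elim (x≢w x≡w)
...   | inj₂ y≡w = ⊥-elim (y≢w y≡w)

explodeAll-exploded : ∀ {n} (G : Graph n) ws {x y} → x ∈ ws ⊎ y ∈ ws → x ≢ y →
  Adj (explodeAll G ws) x y
explodeAll-exploded G (w ∷ ws) (inj₁ (here x≡w)) x≢y =
  explodeAll-⊇ (explode G w) ws (explode-adjacent G w (inj₁ x≡w) x≢y)
explodeAll-exploded G (w ∷ ws) (inj₂ (here y≡w)) x≢y =
  explodeAll-⊇ (explode G w) ws (explode-adjacent G w (inj₂ y≡w) x≢y)
explodeAll-exploded G (w ∷ ws) (inj₁ (there x∈ws)) x≢y = explodeAll-exploded (explode G w) ws (inj₁ x∈ws) x≢y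
explodeAll-exploded G (w ∷ ws) (inj₂ (there y∈ws)) x≢y = explodeAll-exploded (explode G w) ws (inj₂ y∈ws) x≢y

explode-unexploded : ∀ {n} (G : Graph n) w {x y} → x ≢ w → y ≢ w → explode G w x y ≡ G x y
explode-unexploded G w {x} {y} x≢w y≢w with x ≟F w | y ≟F w
... | yes x≡w | _       = ⊥-elim (x≢w x≡w)
... | no _    | yes y≡w = ⊥-elim (y≢w y≡w)
... | no _    | no _    = ∨-identityʳ (G x y)

explodeAll-unexploded : ∀ {n} (G : Graph n) ws {x y} → x ∉ ws → y ∉ ws →
  explodeAll G ws x y ≡ G x y
explodeAll-unexploded G []       x∉ y∉ = refl
explodeAll-unexploded G (w ∷ ws) x∉ y∉ =
  trans (explodeAll-unexploded (explode G w) ws (x∉ ∘ there) (y∉ ∘ there))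
        (explode-unexploded G w (x∉ ∘ here) (y∉ ∘ here))

complete⇒nonadjacent-exploded : ∀ {n} (G : Graph n) ws {x y} → IsComplete (explodeAll G ws) →
  x ≢ y → ¬ Adj G x y → x ∈ ws ⊎ y ∈ ws
complete⇒nonadjacent-exploded G ws {x} {y} complete x≢y ¬adj with any? (x ≟F_) ws | any? (y ≟F_) ws
... | yes x∈ | _     = inj₁ x∈
... | no _   | yes y∈ = inj₂ y∈
... | no x∉  | no y∉  = ⊥-elim (¬adj (subst T (explodeAll-unexploded G ws x∉ y∉) (complete x y x≢y)))

explodedᵇ : ∀ {n} → List (Fin n) → ℕ → Bool
explodedᵇ ws s = any (λ w → s ≡ᵇ toℕ w) ws

∈⇒explodedᵇ : ∀ {n} {x : Fin n} {ws} → x ∈ ws → T (explodedᵇ ws (toℕ x))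
∈⇒explodedᵇ {x = x}          (here refl) = T-∨ˡ _ (≡⇒≡ᵇ (toℕ x) (toℕ x) refl)
∈⇒explodedᵇ {x = x} {w ∷ ws} (there x∈) = T-∨ʳ (toℕ x ≡ᵇ toℕ w) (∈⇒explodedᵇ x∈)

module _ {k b : ℕ} (rb≤k : r b ≤ k) where

  private
    G = Jaco (suc k)
    b≤k : b ≤ k
    b≤k = ≤-trans (m≤n+m b 2) (≤-trans (2+a≤r b) rb≤k)

  unreached-exploded : ∀ {c s} (ws : List (Fin (suc k))) → IsComplete (explodeAll G ws) →
    c ≤ k → s ≤ k → r c ≤ s → ¬ T (explodedᵇ ws c) → T (explodedᵇ ws s)
  unreached-exploded {c} {s} ws complete c≤k s≤k rc≤s c-kept =
    [ ⊥-elim ∘ c-kept ∘ exploded toℕx , exploded toℕy ]′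
      (complete⇒nonadjacent-exploded G ws complete x≢y ¬adj)
    where
    x = fromℕ< (s≤s c≤k)
    y = fromℕ< (s≤s s≤k)
    toℕx : toℕ x ≡ c
    toℕx = toℕ-fromℕ< (s≤s c≤k)
    toℕy : toℕ y ≡ s
    toℕy = toℕ-fromℕ< (s≤s s≤k)
    exploded : ∀ {z t} → toℕ z ≡ t → z ∈ ws → T (explodedᵇ ws t)
    exploded z≡t z∈ = subst (T ∘ explodedᵇ ws) z≡t (∈⇒explodedᵇ z∈)
    c<s : c < s
    c<s = <-≤-trans (a<r c) rc≤s
    x≢y : x ≢ y
    x≢y x≡y = <⇒≢ c<s (trans (sym toℕx) (trans (cong toℕ x≡y) toℕy))
    ¬adj : ¬ Adj G x y
    ¬adj adj = <⇒≱ (≤ᵇ⇒≤ (suc s) (r c) (subst T (adjacentᵇ-< c<s)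
                 (subst₂ (λ u v → T (adjacentᵇ u v)) toℕx toℕy adj))) rc≤s

  mcPherson-lower : ∀ ws → IsComplete (explodeAll G ws) → suc b ≤ length ws
  mcPherson-lower ws complete = ≤-trans forced (count-any-≡ᵇ≤length (suc k) toℕ ws)
    where
    open ≤-Reasoning
    forced : suc b ≤ count (suc k) (explodedᵇ ws)
    forced with all<-or-least-counterexample (explodedᵇ ws) (suc b)
    ... | inj₁ all = begin
      suc b                        ≡⟨ trans (count-<ᵇ (suc k) (suc b)) (m≥n⇒m⊓n≡n (s≤s b≤k)) ⟨
      count (suc k) (_<ᵇ suc b)    ≤⟨ count-mono (suc k) (λ t _ → all t ∘ <ᵇ⇒< t (suc b)) ⟩
      count (suc k) (explodedᵇ ws) ∎
    ... | inj₂ (c , c<1+b , c-kept , below) = begin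
      suc b                                         ≤⟨ gap ⟩
      c + (suc k ∸ r c)                             ≡⟨ count-outside (<⇒≤ (a<r c)) rc≤1+k ⟨
      count (suc k) (λ s → (s <ᵇ c) ∨ (r c ≤ᵇ s))   ≤⟨ count-mono (suc k) cover ⟩
      count (suc k) (explodedᵇ ws)                  ∎
      where
      c≤b = ≤-pred c<1+b
      rc+b≤c+k : r c + b ≤ c + k
      rc+b≤c+k = ≤-trans (r[c]+b≤c+r[b] c≤b) (+-monoʳ-≤ c rb≤k)
      rc≤1+k : r c ≤ suc k
      rc≤1+k = ≤-trans (r-mono c≤b) (m≤n⇒m≤1+n rb≤k)
      1+b+rc≤c+1+k : suc b + r c ≤ c + suc k
      1+b+rc≤c+1+k = begin
        suc b + r c   ≡⟨ +-comm (suc b) (r c) ⟩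
        r c + suc b   ≡⟨ +-suc (r c) b ⟩
        suc (r c + b) ≤⟨ s≤s rc+b≤c+k ⟩
        suc (c + k)   ≡⟨ +-suc c k ⟨
        c + suc k     ∎
      gap : suc b ≤ c + (suc k ∸ r c)
      gap = begin
        suc b             ≤⟨ m+n≤o⇒m≤o∸n (suc b) 1+b+rc≤c+1+k ⟩
        c + suc k ∸ r c   ≡⟨ +-∸-assoc c rc≤1+k ⟩
        c + (suc k ∸ r c) ∎
      cover : ∀ s → s < suc k → T ((s <ᵇ c) ∨ (r c ≤ᵇ s)) → T (explodedᵇ ws s)
      cover s s<1+k t with Equivalence.to T-∨ t
      ... | inj₁ s<c  = below s (<ᵇ⇒< s c s<c)
      ... | inj₂ rc≤s = unreached-exploded ws complete (≤-trans c≤b b≤k) (≤-pred s<1+k)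
                          (≤ᵇ⇒≤ (r c) s rc≤s) c-kept

  initial : List (Fin (suc k))
  initial = filterᵇ (λ y → toℕ y <ᵇ suc b) (allFin (suc k))

  length-initial : length initial ≡ suc b
  length-initial =
    trans (length-filterᵇ-tabulate (suc k) (λ z → z) _ (_<ᵇ suc b) (λ _ → refl))
          (trans (count-<ᵇ (suc k) (suc b)) (m≥n⇒m⊓n≡n (s≤s b≤k)))

  ∈-initial : ∀ {z} → toℕ z < suc b → z ∈ initial
  ∈-initial {z} z<1+b = ∈-filter⁺ (T? ∘ (λ y → toℕ y <ᵇ suc b)) (∈-allFin z) (<⇒<ᵇ z<1+b)

  beyond-initial-adjacent : k < r (suc b) → ∀ {x y : Fin (suc k)} →
    suc b ≤ toℕ x → toℕ x < toℕ y → Adj G x y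
  beyond-initial-adjacent k<r {x} {y} 1+b≤x x<y =
    <r⇒adjacent x<y (<-≤-trans (≤-trans (toℕ<n y) k<r) (r-mono 1+b≤x))

  initial-complete : k < r (suc b) → IsComplete (explodeAll G initial)
  initial-complete k<r x y x≢y with toℕ x <? suc b | toℕ y <? suc b | <-cmp (toℕ x) (toℕ y)
  ... | yes x< | _      | _ = explodeAll-exploded G initial (inj₁ (∈-initial x<)) x≢y
  ... | no _   | yes y< | _ = explodeAll-exploded G initial (inj₂ (∈-initial y<)) x≢y
  ... | no _   | no _   | tri≈ _ x≡y _ = ⊥-elim (x≢y (toℕ-injective x≡y))
  ... | no x≮  | no _   | tri< x<y _ _ =
    explodeAll-⊇ G initial (beyond-initial-adjacent k<r (≮⇒≥ x≮) x<y)
  ... | no _   | no y≮  | tri> _ _ y<x =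
    explodeAll-⊇ G initial (subst T (adjacentᵇ-sym (toℕ y) (toℕ x))
                              (beyond-initial-adjacent k<r (≮⇒≥ y≮) y<x))

  mcPherson : k < r (suc b) → McPhersonNumber G (suc b)
  mcPherson k<r = (initial , length-initial , initial-complete k<r) , mcPherson-lower

adjacent-last : ∀ {k} (x : Fin (suc k)) → toℕ x < k →
  Jaco (suc k) x (fromℕ k) ≡ (suc k ≤ᵇ r (toℕ x))
adjacent-last {k} x x<k =
  trans (cong (adjacentᵇ (toℕ x)) (toℕ-fromℕ k)) (adjacentᵇ-< x<k)

degree-fromℕ< : ∀ {k t} (t<1+k : t < suc k) → degree (Jaco (suc k)) (fromℕ< t<1+k) ≡ deg k t
degree-fromℕ< {k} t<1+k = trans (degree-Jaco k _) (cong (deg k) (toℕ-fromℕ< t<1+k))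

module _ {k : ℕ} {x : Fin (suc k)} (prime : IsPrimeJaconian (Jaco (suc k)) x) where

  private
    G = Jaco (suc k)
    a = toℕ x

  deg≤prime : ∀ {t} → t ≤ k → deg k t ≤ deg k a
  deg≤prime {t} t≤k = begin
    deg k t                      ≡⟨ degree-fromℕ< (s≤s t≤k) ⟨
    degree G (fromℕ< (s≤s t≤k))  ≤⟨ proj₁ prime (fromℕ< (s≤s t≤k)) ⟩
    degree G x                   ≡⟨ degree-Jaco k x ⟩
    deg k a                      ∎
    where open ≤-Reasoning

  deg<prime : ∀ {t} → t < a → deg k t < deg k a
  deg<prime {t} t<a = ≰⇒> λ deg-a≤deg-t →
    <⇒≱ t<a (≤-trans (proj₂ prime y (y-max deg-a≤deg-t)) (≤-reflexive (toℕ-fromℕ< t<1+k)))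
    where
    t<1+k : t < suc k
    t<1+k = <-trans t<a (toℕ<n x)
    y = fromℕ< t<1+k
    y-max : deg k a ≤ deg k t → IsMaxDegree G y
    y-max deg-a≤deg-t z = begin
      degree G z  ≤⟨ proj₁ prime z ⟩
      degree G x  ≡⟨ degree-Jaco k x ⟩
      deg k a     ≤⟨ deg-a≤deg-t ⟩
      deg k t     ≡⟨ degree-fromℕ< t<1+k ⟨
      degree G y  ∎
      where open ≤-Reasoning

  not-prime-after : ∀ {b} → b < k → k < r b → a ≢ suc b
  not-prime-after {b} b<k k<rb a≡1+b =
    <⇒≱ (deg<prime (subst (b <_) (sym a≡1+b) (n<1+n b)))
        (subst (λ z → deg k z ≤ deg k b) (sym a≡1+b) (deg-suc≤ b<k k<rb))

  prime<k : 2 ≤ k → a < k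
  prime<k 2≤k with m≤n⇒m<n∨m≡n (≤-pred (toℕ<n x))
  ... | inj₁ a<k = a<k
  ... | inj₂ a≡k = ⊥-elim (not-prime-after pred<k k<r[pred] (trans a≡k (sym 1+pred≡k)))
    where
    1+pred≡k : suc (pred k) ≡ k
    1+pred≡k = suc-pred k {{>-nonZero (<-trans z<s 2≤k)}}
    pred<k : pred k < k
    pred<k = subst (pred k <_) 1+pred≡k (n<1+n (pred k))
    k<r[pred] : k < r (pred k)
    k<r[pred] = subst (_≤ r (pred k)) (cong suc 1+pred≡k) (2+a≤r (pred k))

  prime-adjacent : 2 ≤ k → k < r a → ∃[ b ] a ≡ suc b × r b ≤ k × k < r (suc b)
  prime-adjacent 2≤k k<ra = split a refl
    where
    split : ∀ a′ → a ≡ a′ → ∃[ b ] a ≡ suc b × r b ≤ k × k < r (suc b)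
    split zero    a≡0   = ⊥-elim (<⇒≱ k<ra (subst (λ z → r z ≤ k) (sym a≡0) 2≤k))
    split (suc b) a≡1+b =
      b , a≡1+b , ≮⇒≥ (λ k<rb → not-prime-after b<k k<rb a≡1+b) , subst (λ z → k < r z) a≡1+b k<ra
      where
      b<k : b < k
      b<k = <-trans (n<1+n b) (subst (_< k) a≡1+b (prime<k 2≤k))

  prime-nonadjacent : r a ≤ k → k < r (suc a)
  prime-nonadjacent ra≤k = ≰⇒> λ r[1+a]≤k →
    <⇒≱ (subst₂ _<_ (sym (deg≡suc ra≤k)) (sym (deg≡suc r[1+a]≤k)) (n<1+n (suc a)))
        (deg≤prime (≤-trans (m≤n+m (suc a) 2) (≤-trans (2+a≤r (suc a)) r[1+a]≤k)))

theorem2p3 : (k : ℕ) → 2 ≤ k → (x : Fin (suc k)) →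
    IsPrimeJaconian (Jaco (suc k)) x →
    (¬ Adj (Jaco (suc k)) x (fromℕ k) → McPhersonNumber (Jaco (suc k)) (suc (toℕ x)))
    × (Adj (Jaco (suc k)) x (fromℕ k) → McPhersonNumber (Jaco (suc k)) (toℕ x))
theorem2p3 k 2≤k x prime = nonadjacent-case , adjacent-case
  where
  G = Jaco (suc k)
  x<k = prime<k prime 2≤k
  nonadjacent-case : ¬ Adj G x (fromℕ k) → McPhersonNumber G (suc (toℕ x))
  nonadjacent-case ¬adj = mcPherson {b = toℕ x} ra≤k (prime-nonadjacent prime ra≤k)
    where
    ra≤k : r (toℕ x) ≤ k
    ra≤k = ≮⇒≥ (¬adj ∘ subst T (sym (adjacent-last x x<k)) ∘ ≤⇒≤ᵇ)
  adjacent-case : Adj G x (fromℕ k) → McPhersonNumber G (toℕ x)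
  adjacent-case adj with prime-adjacent prime 2≤k (≤ᵇ⇒≤ (suc k) _ (subst T (adjacent-last x x<k) adj))
  ... | b , a≡1+b , rb≤k , k<r = subst (McPhersonNumber G) (sym a≡1+b) (mcPherson {b = b} rb≤k k<r)
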